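{- For every integer $n\ge0$ and all $x,y\in\mathbb{Z}$, the difference table satisfies $F'(x,y)=-F'(y,x)$.
   Context: For a fixed integer $n\ge0$, define $F:\mathbb{Z}^2\to\mathbb{Z}_{\ge0}$ by $F(0,0)=2^n$, $F(x,y)=\lfloor F(x-1,y)/2\rfloor+\lfloor F(x,y-1)/2\rfloor$ for every $(x,y)\in\mathbb{Z}_{\ge0}^2\setminus\{(0,0)\}$, and $F(x,y)=0$ for $(x,y)$ outside the first quadrant (the intermediate firing configuration of chip-firing on the quadrant lattice graph started with $2^n$ chips at the origin). The difference table is $F'(x,y)=F(x-1,y)-F(x,y-1)$ for $(x,y)\in\mathbb{Z}^2$. -}

module Defs where

open import Data.Nat using (ℕ; zero; suc; _+_; _^_; _/_)
open import Data.Integer using (ℤ; +_; -[1+_]; _-_)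

-- F restricted to the first quadrant (x, y ≥ 0), following the recursion
-- F(0,0) = 2^n, F(x,y) = ⌊F(x-1,y)/2⌋ + ⌊F(x,y-1)/2⌋, with F = 0 outside
-- the quadrant (so the out-of-quadrant summand is ⌊0/2⌋ = 0 and omitted).
Fℕ : ℕ → ℕ → ℕ → ℕ
Fℕ n zero    zero    = 2 ^ n
Fℕ n (suc x) zero    = Fℕ n x zero / 2
Fℕ n zero    (suc y) = Fℕ n zero y / 2
Fℕ n (suc x) (suc y) = Fℕ n x (suc y) / 2 + Fℕ n (suc x) y / 2

F : ℕ → ℤ → ℤ → ℤ
F n (+ x)    (+ y)    = + Fℕ n x y
F n (+ x)    -[1+ y ] = + 0
F n -[1+ x ] _        = + 0

F′ : ℕ → ℤ → ℤ → ℤ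
F′ n x y = F n (x - + 1) y - F n x (y - + 1)

{-# OPTIONS --safe #-}
-- The recursion defining F is invariant under swapping the two coordinates,
-- so F(x,y) = F(y,x); hence F′(y,x) is F′(x,y) with its two terms exchanged.
module Submission where

open import Defs
open import Data.Nat using (ℕ; zero; suc; _+_; _/_)
import Data.Nat.Properties as ℕ
open import Data.Integer using (ℤ; +_; -[1+_]; -_; _-_)
open import Data.Integer.Properties using (+-0-abelianGroup)
open import Algebra.Properties.AbelianGroup +-0-abelianGroup using (⁻¹-anti-homo‿-)
open import Relation.Binary.PropositionalEquality using (_≡_; refl; cong; cong₂)
open import Relation.Binary.PropositionalEquality.Properties using (module ≡-Reasoning)

Fℕ-comm : ∀ n x y → Fℕ n x y ≡ Fℕ n y x
Fℕ-comm n zero    zero    = refl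
Fℕ-comm n (suc x) zero    = cong (_/ 2) (Fℕ-comm n x zero)
Fℕ-comm n zero    (suc y) = cong (_/ 2) (Fℕ-comm n zero y)
Fℕ-comm n (suc x) (suc y) = begin
  Fℕ n x (suc y) / 2 + Fℕ n (suc x) y / 2
    ≡⟨ cong₂ _+_ (cong (_/ 2) (Fℕ-comm n x (suc y))) (cong (_/ 2) (Fℕ-comm n (suc x) y)) ⟩
  Fℕ n (suc y) x / 2 + Fℕ n y (suc x) / 2
    ≡⟨ ℕ.+-comm (Fℕ n (suc y) x / 2) (Fℕ n y (suc x) / 2) ⟩
  Fℕ n y (suc x) / 2 + Fℕ n (suc y) x / 2
    ∎
  where open ≡-Reasoning

F-comm : ∀ n x y → F n x y ≡ F n y x
F-comm n (+ x)    (+ y)    = cong +_ (Fℕ-comm n x y)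
F-comm n (+ x)    -[1+ y ] = refl
F-comm n -[1+ x ] (+ y)    = refl
F-comm n -[1+ x ] -[1+ y ] = refl

proposition9p3 : (n : ℕ) (x y : ℤ) → F′ n x y ≡ - F′ n y x
proposition9p3 n x y = begin
  F n (x - + 1) y - F n x (y - + 1)     ≡⟨ cong₂ _-_ (F-comm n (x - + 1) y) (F-comm n x (y - + 1)) ⟩
  F n y (x - + 1) - F n (y - + 1) x     ≡⟨ ⁻¹-anti-homo‿- (F n (y - + 1) x) (F n y (x - + 1)) ⟨
  - (F n (y - + 1) x - F n y (x - + 1)) ∎
  where open ≡-Reasoning
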